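{- $\mathfrak{L}(\mathsf{Kh})$ is strictly more expressive than $\mathfrak{L}(\mathsf{A})$ over labelled transition systems. More precisely: every $\mathfrak{L}(\mathsf{A})$ formula is equivalent (has the same truth set in every labelled transition system) to some $\mathfrak{L}(\mathsf{Kh})$ formula, and there is an $\mathfrak{L}(\mathsf{Kh})$ formula, e.g. $\mathsf{Kh}(p,q)$ for distinct propositional symbols $p,q$, that is not equivalent over labelled transition systems to any $\mathfrak{L}(\mathsf{A})$ formula.
   Context: Fix countable sets $\mathsf{Prop}$ of propositional symbols and $\mathsf{Act}$ of action symbols. Formulas of $\mathfrak{L}(\mathsf{Kh})$: $\varphi,\psi ::= p \mid \neg\varphi \mid \varphi\lor\psi \mid \mathsf{Kh}(\varphi,\psi)$ with $p\in\mathsf{Prop}$ (with $\bot,\top,\land,\to,\leftrightarrow$ as usual abbreviations). Formulas of $\mathfrak{L}(\mathsf{A})$: $\varphi ::= p \mid \neg\varphi\mid\varphi\lor\varphi\mid \mathsf{A}\varphi$, with $\mathsf{E}\varphi := \neg\mathsf{A}\neg\varphi$. A labelled transition system (LTS) is $\mathfrak{M}=\langle S,(R_a)_{a\in\mathsf{Act}},V\rangle$ with $S$ a non-empty set, each $R_a\subseteq S\times S$, and $V:\mathsf{Prop}\to 2^S$. For plans $\pi\in\mathsf{Act}^*$: $R_\varepsilon$ is the identity on $S$, $R_{\pi a}$ is the relational composition of $R_\pi$ then $R_a$; $R_\pi(X)=\{t: \exists s\in X, (s,t)\in R_\pi\}$. For $\pi=a_1\dots a_n$, $\pi$ is strongly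 executable at $s$ iff for all $0\le i<n$ and all $t\in R_{a_1\dots a_i}(s)$, $R_{a_{i+1}}(t)\neq\emptyset$; $\mathrm{SE}(\pi)$ is the set of such $s$. Truth sets: $[\![p]\!]=V(p)$, $[\![\neg\varphi]\!]=S\setminus[\![\varphi]\!]$, $[\![\varphi\lor\psi]\!]=[\![\varphi]\!]\cup[\![\psi]\!]$, $[\![\mathsf{Kh}(\varphi,\psi)]\!]=S$ if there is $\pi\in\mathsf{Act}^*$ with $[\![\varphi]\!]\subseteq\mathrm{SE}(\pi)$ and $R_\pi([\![\varphi]\!])\subseteq[\![\psi]\!]$, and $\emptyset$ otherwise; $[\![\mathsf{A}\varphi]\!]=S$ if $[\![\varphi]\!]=S$ and $\emptyset$ otherwise. -}

module Defs where

open import Data.Nat using (ℕ)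
open import Data.List using (List; []; _∷_; length; take; lookup)
open import Data.Fin using (Fin; toℕ)
open import Data.Product using (Σ; ∃; _×_)
open import Data.Sum using (_⊎_)
open import Data.Empty using (⊥)
open import Data.Unit using (⊤)
open import Relation.Nullary using (¬_)
open import Relation.Binary.PropositionalEquality using (_≡_)

PropSym : Set
PropSym = ℕ

Act : Set
Act = ℕ

Plan : Set
Plan = List Act

data FormKh : Set where
  atom : PropSym → FormKh
  neg  : FormKh → FormKh
  or   : FormKh → FormKh → FormKh
  Kh   : FormKh → FormKh → FormKh

data FormA : Set where
  atom : PropSym → FormA
  neg  : FormA → FormA
  or   : FormA → FormA → FormA
  A    : FormA → FormA

record LTS : Set₁ where
  field
    S : Set
    nonempty : S
    R : Act → S → S → Set
    V : PropSym → S → Set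

module _ (M : LTS) where
  open LTS M

  Rπ : Plan → S → S → Set
  Rπ [] s t = s ≡ t
  Rπ (a ∷ π) s t = ∃ λ u → R a s u × Rπ π u t

  -- strong executability: for all 0 ≤ i < n and t ∈ R_{a₁…aᵢ}(s), R_{aᵢ₊₁}(t) ≠ ∅
  SE : Plan → S → Set
  SE π s = (i : Fin (length π)) (t : S) → Rπ (take (toℕ i) π) s t
           → ∃ λ u → R (lookup π i) t u

  ⟦_⟧Kh : FormKh → S → Set
  ⟦ atom p ⟧Kh s = V p s
  ⟦ neg φ ⟧Kh s = ¬ ⟦ φ ⟧Kh s
  ⟦ or φ ψ ⟧Kh s = ⟦ φ ⟧Kh s ⊎ ⟦ ψ ⟧Kh s
  ⟦ Kh φ ψ ⟧Kh _ = Σ Plan λ π →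
      ((t : S) → ⟦ φ ⟧Kh t → SE π t)
    × ((t u : S) → ⟦ φ ⟧Kh t → Rπ π t u → ⟦ ψ ⟧Kh u)

  ⟦_⟧A : FormA → S → Set
  ⟦ atom p ⟧A s = V p s
  ⟦ neg φ ⟧A s = ¬ ⟦ φ ⟧A s
  ⟦ or φ ψ ⟧A s = ⟦ φ ⟧A s ⊎ ⟦ ψ ⟧A s
  ⟦ A φ ⟧A _ = (t : S) → ⟦ φ ⟧A t

_≋_ : FormA → FormKh → Set₁
α ≋ φ = (M : LTS) (s : LTS.S M) →
  (⟦ M ⟧A α s → ⟦ M ⟧Kh φ s) × (⟦ M ⟧Kh φ s → ⟦ M ⟧A α s)

-- The universal modality is definable: A φ holds iff one knows how to reach a
-- contradiction from ¬φ, i.e. Kh(¬φ, ⊥); the empty plan witnesses one direction,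
-- and for the other a strongly executable plan from any ¬φ-state would lead to a
-- ⊥-state, so ¬φ is empty. Conversely, L(A) never inspects the transition
-- relations, so it cannot separate two models that differ only there, while
-- Kh(p, q) does: on Bool with p true exactly at true and q exactly at false, it
-- fails without transitions and holds when every action leads to false.
module Submission where

open import Defs
open import Level using (0ℓ)
open import Axiom.ExcludedMiddle using (ExcludedMiddle)
open import Data.Product using (Σ; _×_; _,_; proj₁; proj₂; ∃)
open import Data.Sum using (_⊎_; inj₁; inj₂)
open import Data.Empty using (⊥; ⊥-elim)
open import Data.Bool using (Bool; true; false)
open import Data.List using ([]; _∷_)
open import Data.Fin using (zero; suc)
open import Relation.Nullary using (¬_)
open import Relation.Nullary.Decidable using (decidable-stable)
open import Relation.Binary.PropositionalEquality using (_≡_; _≢_; refl; sym)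

falsum : FormKh
falsum = neg (or (atom 0) (neg (atom 0)))

module _ (M : LTS) where

  SE⇒reachable : ∀ π {t} → SE M π t → ∃ λ u → Rπ M π t u
  SE⇒reachable [] se = _ , refl
  SE⇒reachable (a ∷ π) se with se zero _ refl
  ... | u , t→u with SE⇒reachable π (λ i v u→v → se (suc i) v (u , t→u , u→v))
  ... | v , u→v = v , u , t→u , u→v

  falsum-empty : ∀ {s} → ¬ ⟦ M ⟧Kh falsum s
  falsum-empty h = h (inj₂ (λ x → h (inj₁ x)))

  Kh-falsum⇒empty : ∀ ψ {s} → ⟦ M ⟧Kh (Kh ψ falsum) s → ∀ t → ¬ ⟦ M ⟧Kh ψ t
  Kh-falsum⇒empty ψ (π , se , post) t ψt with SE⇒reachable π (se t ψt)
  ... | u , t→u = falsum-empty (post t u ψt t→u)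

  universal⇒Kh-neg-falsum : ∀ φ {s} → (∀ t → ⟦ M ⟧Kh φ t) → ⟦ M ⟧Kh (Kh (neg φ) falsum) s
  universal⇒Kh-neg-falsum φ all-φ = [] , (λ t ¬φt → ⊥-elim (¬φt (all-φ t)))
                                     , (λ t _ ¬φt _ → ⊥-elim (¬φt (all-φ t)))

  Kh-neg-falsum⇒universal : ExcludedMiddle 0ℓ →
    ∀ φ {s} → ⟦ M ⟧Kh (Kh (neg φ) falsum) s → ∀ t → ⟦ M ⟧Kh φ t
  Kh-neg-falsum⇒universal em φ {s} kh t =
    decidable-stable em (Kh-falsum⇒empty (neg φ) {s} kh t)

translate : FormA → FormKh
translate (atom p) = atom p
translate (neg α)  = neg (translate α)
translate (or α β) = or (translate α) (translate β)
translate (A α)    = Kh (neg (translate α)) falsum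

translate-sound : ExcludedMiddle 0ℓ → ∀ α → α ≋ translate α
translate-sound em (atom p) M s = (λ x → x) , (λ x → x)
translate-sound em (neg α) M s =
  (λ ¬a t → ¬a (proj₂ (translate-sound em α M s) t)) ,
  (λ ¬t a → ¬t (proj₁ (translate-sound em α M s) a))
translate-sound em (or α β) M s =
  (λ { (inj₁ a) → inj₁ (proj₁ (translate-sound em α M s) a)
     ; (inj₂ b) → inj₂ (proj₁ (translate-sound em β M s) b) }) ,
  (λ { (inj₁ a) → inj₁ (proj₂ (translate-sound em α M s) a)
     ; (inj₂ b) → inj₂ (proj₂ (translate-sound em β M s) b) })
translate-sound em (A α) M s =
  (λ all-α → universal⇒Kh-neg-falsum M (translate α) {s} λ t →
               proj₁ (translate-sound em α M t) (all-α t)) ,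
  (λ kh t → proj₂ (translate-sound em α M t)
              (Kh-neg-falsum⇒universal M em (translate α) {s} kh t))

⟦⟧A-independent-of-R : (M : LTS) (R′ : Act → LTS.S M → LTS.S M → Set) → ∀ α s →
  ⟦ M ⟧A α s → ⟦ record M { R = R′ } ⟧A α s
⟦⟧A-independent-of-R M R′ (atom p) s x = x
-- Restoring R in record M { R = R′ } gives back M by η for records.
⟦⟧A-independent-of-R M R′ (neg α) s ¬a a =
  ¬a (⟦⟧A-independent-of-R (record M { R = R′ }) (LTS.R M) α s a)
⟦⟧A-independent-of-R M R′ (or α β) s (inj₁ a) = inj₁ (⟦⟧A-independent-of-R M R′ α s a)
⟦⟧A-independent-of-R M R′ (or α β) s (inj₂ b) = inj₂ (⟦⟧A-independent-of-R M R′ β s b)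
⟦⟧A-independent-of-R M R′ (A α) s all-α t = ⟦⟧A-independent-of-R M R′ α t (all-α t)

module _ (p q : PropSym) (p≢q : p ≢ q) where

  p-at-true-q-at-false : LTS
  p-at-true-q-at-false = record
    { S        = Bool
    ; nonempty = true
    ; R        = λ _ _ _ → ⊥
    ; V        = λ r s → (r ≡ p × s ≡ true) ⊎ (r ≡ q × s ≡ false)
    }

  every-action-to-false : LTS
  every-action-to-false = record p-at-true-q-at-false { R = λ _ _ t → t ≡ false }

  ¬Kh-without-transitions : ¬ ⟦ p-at-true-q-at-false ⟧Kh (Kh (atom p) (atom q)) true
  ¬Kh-without-transitions ([] , _ , post) with post true true (inj₁ (refl , refl)) refl
  ... | inj₁ (q≡p , _)  = p≢q (sym q≡p)
  ... | inj₂ (_ , ())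
  ¬Kh-without-transitions ((a ∷ π) , se , _) with se true (inj₁ (refl , refl)) zero true refl
  ... | _ , ()

  Kh-via-any-action : ⟦ every-action-to-false ⟧Kh (Kh (atom p) (atom q)) true
  Kh-via-any-action = (0 ∷ [])
    , (λ { _ _ zero _ _ → false , refl })
    , (λ { _ _ _ (.false , refl , refl) → inj₂ (refl , refl) })

  Kh-not-A-definable : ¬ (Σ FormA λ α → α ≋ Kh (atom p) (atom q))
  Kh-not-A-definable (α , α≋Kh) =
    ¬Kh-without-transitions (proj₁ (α≋Kh p-at-true-q-at-false true)
      (⟦⟧A-independent-of-R every-action-to-false (λ _ _ _ → ⊥) α true
        (proj₂ (α≋Kh every-action-to-false true) Kh-via-any-action)))

theorem1 : ExcludedMiddle 0ℓ →
    ((α : FormA) → Σ FormKh λ φ → α ≋ φ)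
    × ((p q : PropSym) → p ≢ q → ¬ (Σ FormA λ α → α ≋ Kh (atom p) (atom q)))
theorem1 em = (λ α → translate α , translate-sound em α) , Kh-not-A-definable
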